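{- Let $p$ be a prime and $n,k$ positive integers such that $S(n,k)$ is a minimum zero case. Let $b$ be an integer with $0\le b<\min\{p^{\nu_p(k)},p^{\nu_p(n)}\}$, and put $n'=n+b$, $k'=k+b$. Then $S(n',k')$ is a minimum zero case, and (i) $\nu_p(S(n',k'))=\nu_p(S(n,k))$; (ii) $\epsilon_p(S(n',k'))\equiv \epsilon_p(S(n,k)) \pmod p$.
   Context: $S(n,k)$ is the Stirling number of the second kind, $\nu_p$ the $p$-adic valuation, $\sigma_p(m)$ the base-$p$ digit sum, and $\epsilon_p(x)=p^{ -\nu_p(x)}x$ the unit part of a nonzero rational $x$. $S(n,k)$ is called a minimum zero case if $\nu_p(S(n,k)) = (\sigma_p(k)-\sigma_p(n))/(p-1)$. -}

module Defs where

open import Data.Nat.Base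
open import Data.Nat.Divisibility using (_∣_; _∣?_)
open import Data.Nat.DivMod using (_/_)
open import Data.Nat.Primality using (Prime)
open import Relation.Nullary using (¬_; yes; no)
open import Relation.Binary.PropositionalEquality using (_≡_)
open import Data.Product using (_×_)

S : ℕ → ℕ → ℕ
S zero    zero    = 1
S zero    (suc k) = 0
S (suc n) zero    = 0
S (suc n) (suc k) = suc k * S n (suc k) + S n k

-- Base-p digit sum (with fuel = m, which suffices since m / p < m for p ≥ 2).
digitSumAux : ℕ → (p : ℕ) → .{{NonZero p}} → ℕ → ℕ
digitSumAux zero       p m = 0
digitSumAux (suc fuel) p m with m
... | zero  = 0
... | suc r = suc r % p + digitSumAux fuel p (suc r / p)

σ : (p : ℕ) → .{{NonZero p}} → ℕ → ℕ
σ p m = digitSumAux m p m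

-- p-adic valuation of a natural number (fuel = x; meaningful for x ≠ 0, p ≥ 2).
νAux : ℕ → (p : ℕ) → .{{NonZero p}} → ℕ → ℕ
νAux zero       p x = 0
νAux (suc fuel) p x with x
... | zero  = 0
... | suc r with p ∣? suc r
...   | yes _ = suc (νAux fuel p (suc r / p))
...   | no  _ = 0

ν : (p : ℕ) → .{{NonZero p}} → ℕ → ℕ
ν p x = νAux x p x

-- Unit part ε_p(x) = p^{-ν_p(x)} x of a nonzero natural x: divide out p
-- exactly ν_p(x) times (same recursion as νAux).
εAux : ℕ → (p : ℕ) → .{{NonZero p}} → ℕ → ℕ
εAux zero       p x = x
εAux (suc fuel) p x with x
... | zero  = 0
... | suc r with p ∣? suc r
...   | yes _ = εAux fuel p (suc r / p)
...   | no  _ = suc r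

ε : (p : ℕ) → .{{NonZero p}} → ℕ → ℕ
ε p x = εAux x p x

-- S(n,k) is a minimum zero case: S(n,k) ≠ 0 and
-- ν_p(S(n,k)) = (σ_p(k) - σ_p(n)) / (p - 1), written without division/subtraction
-- as an equation in ℤ-free form: (p-1)·ν_p(S(n,k)) + σ_p(n) = σ_p(k).
MinZeroCase : (p : ℕ) → .{{NonZero p}} → ℕ → ℕ → Set
MinZeroCase p n k = ¬ (S n k ≡ 0) × ((p ∸ 1) * ν p (S n k) + σ p n ≡ σ p k)

module Submission where

-- Write q = p - 1 and
-- σ for the base-p digit sum.  The whole argument rests on the divisibility bound
--   (B)  p^m ∣ S(n,k)  whenever  q·m + σ(n) < σ(k) + q,
-- i.e. ν_p(S(n,k)) ≥ ⌈(σ(k) - σ(n))/q⌉, so a minimum zero case is one where (B) is sharp.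
-- (B) is proved by strong induction on k: a power of p has σ(k) = 1 and the bound is
-- trivial; otherwise k = p^e + p^e·w splits without carries, and the convolution identity
--   Σ_{i+j=n} binom(i,j)·S(i,a)·S(j,b) = binom(a,b)·S(n,a+b)
-- together with Kummer's theorem (from Legendre's formula) and p ∤ binom(a,b) transfers
-- the bound from a and b to a + b.
-- For the theorem, S(n+c+1, k+c+1) - S(n+c, k+c) = (k+c+1)·S(n+c, k+c+1); for c + 1 below
-- p^ν(n) and p^ν(k) the first factor carries p^ν(c+1) and (B) supplies the rest of p^{v+1},
-- where v = ν_p(S(n,k)).  Summing, S(n+b, k+b) ≡ S(n,k) mod p^{v+1}, which gives (i), (ii)
-- and, since σ(n+b) = σ(n) + σ(b) and σ(k+b) = σ(k) + σ(b), the minimum zero property.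

open import Defs
open import Data.Nat.Base
open import Data.Nat.Primality using (Prime; prime⇒nonTrivial; euclidsLemma)
open import Data.Nat.DivMod
open import Data.Nat.Divisibility
open import Data.Nat.Properties
open import Data.Nat.Induction using (<-rec)
open import Data.Product using (_×_; _,_; Σ; proj₁; proj₂)
open import Data.Sum using (_⊎_; inj₁; inj₂)
open import Data.Empty using (⊥-elim)
open import Induction.WellFounded using (WfRec)
open import Relation.Nullary using (yes; no)
open import Relation.Binary.PropositionalEquality
open import Data.Nat.Tactic.RingSolver

-- Binomial coefficients indexed by the two parts: binom i j = (i + j choose i),
-- defined by Pascal's rule.
binom : ℕ → ℕ → ℕ
binom zero    j       = 1
binom (suc i) zero    = 1
binom (suc i) (suc j) = binom i (suc j) + binom (suc i) j

binom-zeroʳ : ∀ i → binom i 0 ≡ 1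
binom-zeroʳ zero    = refl
binom-zeroʳ (suc i) = refl

binom≢0 : ∀ i j → binom i j ≢ 0
binom≢0 zero    j       ()
binom≢0 (suc i) zero    ()
binom≢0 (suc i) (suc j) e = binom≢0 i (suc j) (m+n≡0⇒m≡0 _ e)

binom-factorial : ∀ i j → binom i j * (i ! * j !) ≡ (i + j) !
binom-factorial zero    j    = trans (*-identityˡ _) (*-identityˡ _)
binom-factorial (suc i) zero =
  trans (*-identityˡ _) (trans (*-identityʳ _) (cong _! (sym (+-identityʳ (suc i)))))
binom-factorial (suc i) (suc j) = begin
  (B₁ + B₂) * ((suc i * i !) * (suc j * j !))
    ≡⟨ pascal-split B₁ B₂ i j (i !) (j !) ⟩
  suc i * (B₁ * (i ! * suc j !)) + suc j * (B₂ * (suc i ! * j !))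
    ≡⟨ cong₂ (λ x y → suc i * x + suc j * y)
             (trans (binom-factorial i (suc j)) (cong _! (+-suc i j)))
             (binom-factorial (suc i) j) ⟩
  suc i * suc (i + j) ! + suc j * suc (i + j) !
    ≡⟨ sym (*-distribʳ-+ (suc (i + j) !) (suc i) (suc j)) ⟩
  (suc i + suc j) * suc (i + j) !
    ≡⟨ cong (λ m → suc m * suc (i + j) !) (+-suc i j) ⟩
  suc (suc (i + j)) !
    ≡⟨ cong (λ m → suc m !) (sym (+-suc i j)) ⟩
  (suc i + suc j) ! ∎
  where
  open ≡-Reasoning
  B₁ B₂ : ℕ
  B₁ = binom i (suc j)
  B₂ = binom (suc i) j
  pascal-split : ∀ B₁ B₂ i j I J →
    (B₁ + B₂) * ((suc i * I) * (suc j * J))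
      ≡ suc i * (B₁ * (I * (suc j * J))) + suc j * (B₂ * ((suc i * I) * J))
  pascal-split = solve-∀

-- Sums over the antidiagonal: antidiag h n = Σ_{i + j = n} h i j.
antidiag : (ℕ → ℕ → ℕ) → ℕ → ℕ
antidiag h zero    = h 0 0
antidiag h (suc n) = h 0 (suc n) + antidiag (λ i j → h (suc i) j) n

antidiag-cong : ∀ {h g} n → (∀ i j → h i j ≡ g i j) → antidiag h n ≡ antidiag g n
antidiag-cong zero    e = e 0 0
antidiag-cong (suc n) e = cong₂ _+_ (e 0 (suc n)) (antidiag-cong n (λ i j → e (suc i) j))

antidiag-zero : ∀ n → antidiag (λ _ _ → 0) n ≡ 0
antidiag-zero zero    = refl
antidiag-zero (suc n) = antidiag-zero n

antidiag-+ : ∀ h g n → antidiag (λ i j → h i j + g i j) n ≡ antidiag h n + antidiag g n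
antidiag-+ h g zero    = refl
antidiag-+ h g (suc n) =
  trans (cong (h 0 (suc n) + g 0 (suc n) +_) (antidiag-+ (λ i j → h (suc i) j) (λ i j → g (suc i) j) n))
        (+-exchange (h 0 (suc n)) (g 0 (suc n)) _ _)
  where
  +-exchange : ∀ a b c d → a + b + (c + d) ≡ a + c + (b + d)
  +-exchange = solve-∀

antidiag-* : ∀ c h n → antidiag (λ i j → c * h i j) n ≡ c * antidiag h n
antidiag-* c h zero    = refl
antidiag-* c h (suc n) =
  trans (cong (c * h 0 (suc n) +_) (antidiag-* c (λ i j → h (suc i) j) n))
        (sym (*-distribˡ-+ c _ _))

antidiag-last : ∀ h n → antidiag h (suc n) ≡ antidiag (λ i j → h i (suc j)) n + h (suc n) 0
antidiag-last h zero    = refl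
antidiag-last h (suc n) =
  trans (cong (h 0 (suc (suc n)) +_) (antidiag-last (λ i j → h (suc i) j) n))
        (sym (+-assoc (h 0 (suc (suc n))) _ (h (suc (suc n)) 0)))

antidiag-∣ : ∀ d h n → (∀ i j → i + j ≡ n → d ∣ h i j) → d ∣ antidiag h n
antidiag-∣ d h zero    H = H 0 0 refl
antidiag-∣ d h (suc n) H =
  ∣m∣n⇒∣m+n (H 0 (suc n) refl) (antidiag-∣ d (λ i j → h (suc i) j) n (λ i j e → H (suc i) j (cong suc e)))

-- Binomial convolution Σ_{i+j=n} binom i j · f i · g j: the product of exponential
-- generating functions.
conv : (ℕ → ℕ) → (ℕ → ℕ) → ℕ → ℕ
conv f g = antidiag (λ i j → binom i j * (f i * g j))

-- Leibniz rule: the derivative (index shift) of an EGF product.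
conv-suc : ∀ f g n → conv f g (suc n) ≡ conv (λ i → f (suc i)) g n + conv f (λ j → g (suc j)) n
conv-suc f g zero    = +-comm (binom 0 1 * (f 0 * g 1)) (binom 1 0 * (f 1 * g 0))
conv-suc f g (suc n) = begin
  H 0 (suc (suc n)) + antidiag (λ i j → H (suc i) j) (suc n)
    ≡⟨ cong (H 0 (suc (suc n)) +_) (antidiag-last (λ i j → H (suc i) j) n) ⟩
  H 0 (suc (suc n)) + (antidiag (λ i j → H (suc i) (suc j)) n + H (suc (suc n)) 0)
    ≡⟨ cong (λ x → H 0 (suc (suc n)) + (x + H (suc (suc n)) 0)) pascal ⟩
  H 0 (suc (suc n)) + (antidiag (λ i j → U i (suc j)) n + antidiag (λ i j → V (suc i) j) n + H (suc (suc n)) 0)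
    ≡⟨ regroup (H 0 (suc (suc n))) (antidiag (λ i j → U i (suc j)) n)
                (antidiag (λ i j → V (suc i) j) n) (H (suc (suc n)) 0) ⟩
  (antidiag (λ i j → U i (suc j)) n + U (suc n) 0) + (V 0 (suc n) + antidiag (λ i j → V (suc i) j) n)
    ≡⟨ cong (_+ conv f (λ j → g (suc j)) (suc n)) (sym (antidiag-last U n)) ⟩
  conv (λ i → f (suc i)) g (suc n) + conv f (λ j → g (suc j)) (suc n) ∎
  where
  open ≡-Reasoning
  H U V : ℕ → ℕ → ℕ
  H = λ i j → binom i j * (f i * g j)
  U = λ i j → binom i j * (f (suc i) * g j)
  V = λ i j → binom i j * (f i * g (suc j))
  pascal : antidiag (λ i j → H (suc i) (suc j)) n
         ≡ antidiag (λ i j → U i (suc j)) n + antidiag (λ i j → V (suc i) j) n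
  pascal = trans (antidiag-cong n (λ i j → *-distribʳ-+ (f (suc i) * g (suc j)) (binom i (suc j)) (binom (suc i) j)))
                 (antidiag-+ (λ i j → U i (suc j)) (λ i j → V (suc i) j) n)
  regroup : ∀ a b c d → a + (b + c + d) ≡ b + d + (a + c)
  regroup = solve-∀

conv-linearˡ : ∀ {f f₁ f₂} c g n → (∀ i → f i ≡ c * f₁ i + f₂ i) →
  conv f g n ≡ c * conv f₁ g n + conv f₂ g n
conv-linearˡ {f} {f₁} {f₂} c g n e =
  trans (antidiag-cong n (λ i j → trans (cong (λ x → binom i j * (x * g j)) (e i))
                                        (distrib (binom i j) c (f₁ i) (f₂ i) (g j))))
        (trans (antidiag-+ _ _ n) (cong (_+ conv f₂ g n) (antidiag-* c _ n)))
  where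
  distrib : ∀ B c x y z → B * ((c * x + y) * z) ≡ c * (B * (x * z)) + B * (y * z)
  distrib = solve-∀

conv-linearʳ : ∀ {g g₁ g₂} c f n → (∀ j → g j ≡ c * g₁ j + g₂ j) →
  conv f g n ≡ c * conv f g₁ n + conv f g₂ n
conv-linearʳ {g} {g₁} {g₂} c f n e =
  trans (antidiag-cong n (λ i j → trans (cong (λ x → binom i j * (f i * x)) (e j))
                                        (distrib (binom i j) c (g₁ j) (g₂ j) (f i))))
        (trans (antidiag-+ _ _ n) (cong (_+ conv f g₂ n) (antidiag-* c _ n)))
  where
  distrib : ∀ B c x y z → B * (z * (c * x + y)) ≡ c * (B * (z * x)) + B * (z * y)
  distrib = solve-∀

conv-zeroˡ : ∀ g n → conv (λ _ → 0) g n ≡ 0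
conv-zeroˡ g n = trans (antidiag-cong n (λ i j → *-zeroʳ (binom i j))) (antidiag-zero n)

conv-zeroʳ : ∀ f n → conv f (λ _ → 0) n ≡ 0
conv-zeroʳ f n =
  trans (antidiag-cong n (λ i j → trans (cong (binom i j *_) (*-zeroʳ (f i))) (*-zeroʳ (binom i j))))
        (antidiag-zero n)

Spred : ℕ → ℕ → ℕ
Spred n zero    = 0
Spred n (suc k) = S n k

S-suc : ∀ n k → S (suc n) k ≡ k * S n k + Spred n k
S-suc n zero    = refl
S-suc n (suc k) = refl

-- The terms binom (a-1) b · S(n, a-1+b) and binom a (b-1) · S(n, a+b-1) produced by
-- differentiating S(·,a) resp. S(·,b); each vanishes when the lowered index is negative.
lowerˡ : ℕ → ℕ → ℕ → ℕ
lowerˡ n zero    b = 0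
lowerˡ n (suc a) b = binom a b * S n (a + b)

lowerʳ : ℕ → ℕ → ℕ → ℕ
lowerʳ n a zero    = 0
lowerʳ n a (suc b) = binom a b * S n (a + b)

lower-pascal : ∀ n a b → lowerˡ n a b + lowerʳ n a b ≡ binom a b * Spred n (a + b)
lower-pascal n zero    zero    = refl
lower-pascal n zero    (suc b) = refl
lower-pascal n (suc a) zero    =
  trans (+-identityʳ _) (cong (_* S n (a + 0)) (binom-zeroʳ a))
lower-pascal n (suc a) (suc b) =
  trans (cong (λ m → binom a (suc b) * S n (a + suc b) + binom (suc a) b * S n m) (sym (+-suc a b)))
        (sym (*-distribʳ-+ (S n (a + suc b)) (binom a (suc b)) (binom (suc a) b)))

-- The convolution identity behind (e^x - 1)^a / a! · (e^x - 1)^b / b!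
--   = binom a b · (e^x - 1)^(a+b) / (a+b)!.
stirling-conv : ∀ n a b → conv (λ i → S i a) (λ j → S j b) n ≡ binom a b * S n (a + b)
stirling-conv zero    zero    zero    = refl
stirling-conv zero    zero    (suc b) = refl
stirling-conv zero    (suc a) b       = sym (*-zeroʳ (binom (suc a) b))
stirling-conv (suc n) a b = begin
  conv Sa Sb (suc n)
    ≡⟨ conv-suc Sa Sb n ⟩
  conv (λ i → S (suc i) a) Sb n + conv Sa (λ j → S (suc j) b) n
    ≡⟨ cong₂ _+_ (conv-linearˡ a Sb n (λ i → S-suc i a)) (conv-linearʳ b Sa n (λ j → S-suc j b)) ⟩
  (a * conv Sa Sb n + conv (λ i → Spred i a) Sb n) + (b * conv Sa Sb n + conv Sa (λ j → Spred j b) n)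
    ≡⟨ cong₂ (λ x y → (a * X + x) + (b * X + y)) (lowered-left a) (lowered-right b) ⟩
  (a * X + lowerˡ n a b) + (b * X + lowerʳ n a b)
    ≡⟨ cong (λ x → (a * x + lowerˡ n a b) + (b * x + lowerʳ n a b)) (stirling-conv n a b) ⟩
  (a * (binom a b * S n (a + b)) + lowerˡ n a b) + (b * (binom a b * S n (a + b)) + lowerʳ n a b)
    ≡⟨ collect a b (binom a b) (S n (a + b)) (Spred n (a + b)) _ _ (lower-pascal n a b) ⟩
  binom a b * ((a + b) * S n (a + b) + Spred n (a + b))
    ≡⟨ cong (binom a b *_) (sym (S-suc n (a + b))) ⟩
  binom a b * S (suc n) (a + b) ∎
  where
  open ≡-Reasoning
  Sa Sb : ℕ → ℕ
  Sa = λ i → S i a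
  Sb = λ j → S j b
  X : ℕ
  X = conv Sa Sb n
  lowered-left : ∀ a → conv (λ i → Spred i a) Sb n ≡ lowerˡ n a b
  lowered-left zero    = conv-zeroˡ Sb n
  lowered-left (suc a) = stirling-conv n a b
  lowered-right : ∀ b → conv Sa (λ j → Spred j b) n ≡ lowerʳ n a b
  lowered-right zero    = conv-zeroʳ Sa n
  lowered-right (suc b) = stirling-conv n a b
  collect : ∀ a b B Y Z L R → L + R ≡ B * Z →
    (a * (B * Y) + L) + (b * (B * Y) + R) ≡ B * ((a + b) * Y + Z)
  collect a b B Y Z L R e =
    trans (regroup a b B Y L R) (trans (cong ((a + b) * (B * Y) +_) e) (factor a b B Y Z))
    where
    regroup : ∀ a b B Y L R → (a * (B * Y) + L) + (b * (B * Y) + R) ≡ (a + b) * (B * Y) + (L + R)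
    regroup = solve-∀
    factor : ∀ a b B Y Z → (a + b) * (B * Y) + B * Z ≡ B * ((a + b) * Y + Z)
    factor = solve-∀

-- Everything below is relative to a fixed prime p; q = p - 1 is the amount by which
-- one carry lowers a base-p digit sum.
module AtPrime (p : ℕ) .{{_ : NonZero p}} (p-prime : Prime p) where

  q : ℕ
  q = p ∸ 1

  1<p : 1 < p
  1<p = nonTrivial⇒n>1 p {{prime⇒nonTrivial p-prime}}

  p≡1+q : p ≡ suc q
  p≡1+q = from-1< 1<p
    where
    from-1< : ∀ {n} → 1 < n → n ≡ suc (n ∸ 1)
    from-1< {suc n} _ = refl

  1≤q : 1 ≤ q
  1≤q = ∸-monoˡ-≤ 1 1<p

  p∤⇒≢0 : ∀ {w} → p ∤ w → w ≢ 0
  p∤⇒≢0 p∤w refl = p∤w (p ∣0)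

  p^*≡0 : ∀ a {w} → p ^ a * w ≡ 0 → w ≡ 0
  p^*≡0 a {w} e = m*n≡0⇒m≡0 w (p ^ a) {{m^n≢0 p a}} (trans (*-comm w (p ^ a)) e)

  p∤-* : ∀ {u v} → p ∤ u → p ∤ v → p ∤ u * v
  p∤-* {u} {v} p∤u p∤v p∣uv with euclidsLemma u v p-prime p∣uv
  ... | inj₁ p∣u = p∤u p∣u
  ... | inj₂ p∣v = p∤v p∣v

  p^-mono-∣ : ∀ {m n} → m ≤ n → p ^ m ∣ p ^ n
  p^-mono-∣ {m} m≤n with m≤n⇒∃[o]m+o≡n m≤n
  ... | o , refl = subst (p ^ m ∣_) (sym (^-distribˡ-+-* p m o)) (m∣m*n (p ^ o))

  p^-cancel : ∀ m u x → p ∤ u → p ^ m ∣ u * x → p ^ m ∣ x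
  p^-cancel zero    u x p∤u _ = 1∣ x
  p^-cancel (suc m) u x p∤u p^m+1∣ux with euclidsLemma u x p-prime (∣-trans (m∣m*n (p ^ m)) p^m+1∣ux)
  ... | inj₁ p∣u = ⊥-elim (p∤u p∣u)
  ... | inj₂ (divides y refl) =
    subst (p ^ suc m ∣_) (*-comm p y)
      (*-monoʳ-∣ p (p^-cancel m u y p∤u (*-cancelˡ-∣ p (subst (p * p ^ m ∣_) (regroup u y p) p^m+1∣ux))))
    where
    regroup : ∀ a b c → a * (b * c) ≡ c * (a * b)
    regroup = solve-∀

  canonical-aux : ∀ f x → x ≤ f → x ≢ 0 →
    x ≡ p ^ νAux f p x * εAux f p x × p ∤ εAux f p x
  canonical-aux zero    zero    _ x≢0 = ⊥-elim (x≢0 refl)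
  canonical-aux (suc f) zero    _ x≢0 = ⊥-elim (x≢0 refl)
  canonical-aux (suc f) (suc r) r<f _ with p ∣? suc r
  ... | no p∤x = sym (*-identityˡ (suc r)) , p∤x
  ... | yes (divides y x≡yp) =
    let y≡ , p∤ε = canonical-aux f (suc r / p) x/p≤f x/p≢0
    in (begin
      suc r                               ≡⟨ x≡yp ⟩
      y * p                               ≡⟨ cong (_* p) (sym x/p≡y) ⟩
      suc r / p * p                       ≡⟨ cong (_* p) y≡ ⟩
      p ^ νAux f p (suc r / p) * εAux f p (suc r / p) * p
                                          ≡⟨ rotate (p ^ νAux f p (suc r / p)) _ p ⟩
      p ^ suc (νAux f p (suc r / p)) * εAux f p (suc r / p) ∎) , p∤ε
    where
    open ≡-Reasoning
    x/p≡y : suc r / p ≡ y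
    x/p≡y = trans (cong (_/ p) x≡yp) (m*n/n≡m y p)
    x/p≤f : suc r / p ≤ f
    x/p≤f = ≤-pred (≤-trans (m/n<m (suc r) p 1<p) r<f)
    x/p≢0 : suc r / p ≢ 0
    x/p≢0 e = 1+n≢0 (trans x≡yp (cong (_* p) (trans (sym x/p≡y) e)))
    rotate : ∀ a b c → a * b * c ≡ c * a * b
    rotate = solve-∀

  canonical : ∀ {x} → x ≢ 0 → x ≡ p ^ ν p x * ε p x × p ∤ ε p x
  canonical {x} = canonical-aux x x ≤-refl

  p^ν∣ : ∀ {x} → x ≢ 0 → p ^ ν p x ∣ x
  p^ν∣ {x} x≢0 with canonical x≢0
  ... | x≡ , _ = subst (p ^ ν p x ∣_) (sym x≡) (m∣m*n (ε p x))

  exponent-unique : ∀ a b w w' → p ^ a * w ≡ p ^ b * w' → p ∤ w → p ∤ w' → a ≡ b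
  exponent-unique zero    zero    w w' e p∤w p∤w' = refl
  exponent-unique zero    (suc b) w w' e p∤w p∤w' =
    ⊥-elim (p∤w (divides (p ^ b * w') (trans (sym (*-identityˡ w)) (trans e (rotate p (p ^ b) w')))))
    where
    rotate : ∀ a b c → a * b * c ≡ b * c * a
    rotate = solve-∀
  exponent-unique (suc a) zero    w w' e p∤w p∤w' = sym (exponent-unique zero (suc a) w' w (sym e) p∤w' p∤w)
  exponent-unique (suc a) (suc b) w w' e p∤w p∤w' =
    cong suc (exponent-unique a b w w'
      (*-cancelˡ-≡ _ _ p (trans (sym (*-assoc p (p ^ a) w)) (trans e (*-assoc p (p ^ b) w')))) p∤w p∤w')

  ν-ε-unique : ∀ a {w x} → p ∤ w → x ≡ p ^ a * w → ν p x ≡ a × ε p x ≡ w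
  ν-ε-unique a {w} {x} p∤w x≡ =
    let x≡' , p∤ε = canonical x≢0
        ν≡a = exponent-unique (ν p x) a (ε p x) w (trans (sym x≡') x≡) p∤ε p∤w
    in ν≡a , *-cancelˡ-≡ _ _ (p ^ a) {{m^n≢0 p a}} (trans (cong (λ e → p ^ e * ε p x) (sym ν≡a)) (trans (sym x≡') x≡))
    where
    x≢0 : x ≢ 0
    x≢0 x≡0 = p∤⇒≢0 p∤w (p^*≡0 a (trans (sym x≡) x≡0))

  perturbation : ∀ {x v u} t → p ∤ u → x ≡ p ^ v * u + p ^ suc v * t →
    x ≢ 0 × ν p x ≡ v × ε p x % p ≡ u % p
  perturbation {x} {v} {u} t p∤u x≡ = x≢0 , proj₁ ν-ε , trans (cong (_% p) (proj₂ ν-ε)) ([m+kn]%n≡m%n u t p)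
    where
    x≡′ : x ≡ p ^ v * (u + t * p)
    x≡′ = trans x≡ (factor-out (p ^ v) u p t)
      where
      factor-out : ∀ P u p t → P * u + p * P * t ≡ P * (u + t * p)
      factor-out = solve-∀
    p∤u′ : p ∤ u + t * p
    p∤u′ p∣u′ = p∤u (∣m+n∣m⇒∣n (subst (p ∣_) (+-comm u (t * p)) p∣u′) (n∣m*n t))
    ν-ε : ν p x ≡ v × ε p x ≡ u + t * p
    ν-ε = ν-ε-unique v p∤u′ x≡′
    x≢0 : x ≢ 0
    x≢0 x≡0 = p∤⇒≢0 p∤u′ (p^*≡0 v (trans (sym x≡′) x≡0))

  σ-fuel : ∀ f g m → m ≤ f → m ≤ g → digitSumAux f p m ≡ digitSumAux g p m
  σ-fuel zero    zero    m       _       _       = refl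
  σ-fuel zero    (suc g) zero    _       _       = refl
  σ-fuel (suc f) zero    zero    _       _       = refl
  σ-fuel (suc f) (suc g) zero    _       _       = refl
  σ-fuel (suc f) (suc g) (suc r) (s≤s r≤f) (s≤s r≤g) =
    cong (suc r % p +_) (σ-fuel f g (suc r / p) (≤-trans x/p≤r r≤f) (≤-trans x/p≤r r≤g))
    where
    x/p≤r : suc r / p ≤ r
    x/p≤r = ≤-pred (m/n<m (suc r) p 1<p)

  divmod-unique : ∀ {m} d t → d < p → m ≡ d + t * p → m % p ≡ d × m / p ≡ t
  divmod-unique {m} d t d<p m≡ = m%p≡d , *-cancelʳ-≡ _ _ p (+-cancelˡ-≡ d _ _ same-expansion)
    where
    m%p≡d : m % p ≡ d
    m%p≡d = trans (cong (_% p) m≡) (trans ([m+kn]%n≡m%n d t p) (m<n⇒m%n≡m d<p))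
    same-expansion : d + (m / p) * p ≡ d + t * p
    same-expansion = trans (cong (_+ (m / p) * p) (sym m%p≡d)) (trans (sym (m≡m%n+[m/n]*n m p)) m≡)

  σ-digit : ∀ {m} d t → d < p → m ≡ d + t * p → σ p m ≡ d + σ p t
  σ-digit {zero} d t d<p m≡ with m+n≡0⇒m≡0 d (sym m≡) | m*n≡0⇒m≡0 t p (m+n≡0⇒n≡0 d (sym m≡))
  ... | refl | refl = refl
  σ-digit {suc r} d t d<p m≡ with divmod-unique d t d<p m≡
  ... | m%p≡d , m/p≡t =
    cong₂ _+_ m%p≡d (trans (cong (digitSumAux r p) m/p≡t) (σ-fuel r t t t≤r ≤-refl))
    where
    t≤r : t ≤ r
    t≤r = subst (_≤ r) m/p≡t (≤-pred (m/n<m (suc r) p 1<p))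

  σ-low : ∀ e y b → b < p ^ e → σ p (p ^ e * y + b) ≡ σ p y + σ p b
  σ-low zero    y zero    _         = trans (cong (σ p) (trans (+-identityʳ _) (*-identityˡ y))) (sym (+-identityʳ _))
  σ-low zero    y (suc b) (s≤s ())
  σ-low (suc e) y b b<p^e+1 = begin
    σ p (p ^ suc e * y + b)          ≡⟨ σ-digit d (p ^ e * y + c) d<p (trans (cong (p ^ suc e * y +_) b≡) (regroup p (p ^ e) y d c)) ⟩
    d + σ p (p ^ e * y + c)          ≡⟨ cong (d +_) (σ-low e y c c<p^e) ⟩
    d + (σ p y + σ p c)              ≡⟨ +-exchange d (σ p y) (σ p c) ⟩
    σ p y + (d + σ p c)              ≡⟨ cong (σ p y +_) (sym (σ-digit d c d<p b≡)) ⟩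
    σ p y + σ p b                    ∎
    where
    open ≡-Reasoning
    d c : ℕ
    d = b % p
    c = b / p
    d<p : d < p
    d<p = m%n<n b p
    b≡ : b ≡ d + c * p
    b≡ = m≡m%n+[m/n]*n b p
    c<p^e : c < p ^ e
    c<p^e = m<n*o⇒m/o<n (subst (b <_) (*-comm p (p ^ e)) b<p^e+1)
    regroup : ∀ u v y d c → u * v * y + (d + c * u) ≡ d + (v * y + c) * u
    regroup = solve-∀
    +-exchange : ∀ a b c → a + (b + c) ≡ b + (a + c)
    +-exchange = solve-∀

  σ-scale : ∀ e y → σ p (p ^ e * y) ≡ σ p y
  σ-scale e y =
    trans (cong (σ p) (sym (+-identityʳ (p ^ e * y))))
          (trans (σ-low e y 0 (m^n>0 p e)) (+-identityʳ (σ p y)))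

  σ-add : ∀ e {x d} → p ^ e ∣ x → d < p ^ e → σ p (x + d) ≡ σ p x + σ p d
  σ-add e {d = d} (divides W refl) d<p^e =
    trans (cong (λ z → σ p (z + d)) (*-comm W (p ^ e)))
          (trans (σ-low e W d d<p^e) (cong (_+ σ p d) (sym (trans (cong (σ p) (*-comm W (p ^ e))) (σ-scale e W)))))

  σ-one : σ p 1 ≡ 1
  σ-one = σ-digit 1 0 1<p refl

  σ-pos : ∀ {n} → n ≢ 0 → 1 ≤ σ p n
  σ-pos {n} n≢0 with canonical n≢0
  ... | n≡ , p∤ε with ε p n % p in ε%p
  ...   | zero   = ⊥-elim (p∤ε (m%n≡0⇒n∣m (ε p n) p ε%p))
  ...   | suc d' = subst (1 ≤_) (sym σn≡) (s≤s z≤n)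
    where
    σn≡ : σ p n ≡ suc d' + σ p (ε p n / p)
    σn≡ = trans (cong (σ p) n≡)
            (trans (σ-scale (ν p n) (ε p n))
              (σ-digit (suc d') (ε p n / p) (subst (_< p) ε%p (m%n<n (ε p n) p))
                (trans (m≡m%n+[m/n]*n (ε p n) p) (cong (_+ (ε p n / p) * p) ε%p))))

  -- Adding 1 to m causes a = ν(m+1) carries, each lowering the digit sum by p - 1.
  σ-carry : ∀ a m w → suc m ≡ p ^ a * w → p ∤ w → σ p (suc m) + q * a ≡ σ p m + 1
  σ-carry zero m w m+1≡p^0w p∤w with w % p in w%p
  ... | zero  = ⊥-elim (p∤w (m%n≡0⇒n∣m w p w%p))
  ... | suc d = begin
    σ p (suc m) + q * 0   ≡⟨ cong₂ _+_ (σ-digit (suc d) t d+1<p m+1≡) (*-zeroʳ q) ⟩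
    suc d + σ p t + 0     ≡⟨ move-one d (σ p t) ⟩
    d + σ p t + 1         ≡⟨ cong (_+ 1) (sym (σ-digit d t (<⇒≤ d+1<p) (suc-injective m+1≡))) ⟩
    σ p m + 1             ∎
    where
    open ≡-Reasoning
    t : ℕ
    t = w / p
    d+1<p : suc d < p
    d+1<p = subst (_< p) w%p (m%n<n w p)
    m+1≡ : suc m ≡ suc d + t * p
    m+1≡ = trans (trans m+1≡p^0w (*-identityˡ w)) (trans (m≡m%n+[m/n]*n w p) (cong (_+ t * p) w%p))
    move-one : ∀ x y → suc x + y + 0 ≡ x + y + 1
    move-one = solve-∀
  σ-carry (suc a) m w m+1≡p^a+1w p∤w with p ^ a * w in y≡
  ... | zero  = ⊥-elim (p∤⇒≢0 p∤w (p^*≡0 a y≡))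
  ... | suc y = begin
    σ p (suc m) + q * suc a           ≡⟨ cong₂ _+_ (σ-digit 0 (suc y) (<-trans (s≤s z≤n) 1<p) m+1≡) (*-suc q a) ⟩
    σ p (suc y) + (q + q * a)         ≡⟨ regroup (σ p (suc y)) q (q * a) ⟩
    q + (σ p (suc y) + q * a)         ≡⟨ cong (q +_) (σ-carry a y w (sym y≡) p∤w) ⟩
    q + (σ p y + 1)                   ≡⟨ sym (+-assoc q (σ p y) 1) ⟩
    q + σ p y + 1                     ≡⟨ cong (_+ 1) (sym (σ-digit q y (≤-reflexive (sym p≡1+q)) m≡)) ⟩
    σ p m + 1                         ∎
    where
    open ≡-Reasoning
    m+1≡ : suc m ≡ suc y * p
    m+1≡ = trans m+1≡p^a+1w (trans (*-assoc p (p ^ a) w) (trans (cong (p *_) y≡) (*-comm p (suc y))))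
    m≡ : m ≡ q + y * p
    m≡ = suc-injective (trans m+1≡ (cong (_+ y * p) p≡1+q))
    regroup : ∀ x q y → x + (q + y) ≡ q + (x + y)
    regroup = solve-∀

  σ-succ : ∀ m → σ p (suc m) + q * ν p (suc m) ≡ σ p m + 1
  σ-succ m with canonical {suc m} (λ ())
  ... | m+1≡ , p∤ε = σ-carry (ν p (suc m)) m (ε p (suc m)) m+1≡ p∤ε

  ν-one : ν p 1 ≡ 0
  ν-one = proj₁ (ν-ε-unique 0 {1} (>⇒∤ 1<p) refl)

  ν-* : ∀ {x y} → x ≢ 0 → y ≢ 0 → ν p (x * y) ≡ ν p x + ν p y
  ν-* {x} {y} x≢0 y≢0 with canonical x≢0 | canonical y≢0
  ... | x≡ , p∤εx | y≡ , p∤εy =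
    proj₁ (ν-ε-unique (ν p x + ν p y) (p∤-* p∤εx p∤εy) (begin
      x * y                                              ≡⟨ cong₂ _*_ x≡ y≡ ⟩
      p ^ ν p x * ε p x * (p ^ ν p y * ε p y)            ≡⟨ interchange (p ^ ν p x) (ε p x) (p ^ ν p y) (ε p y) ⟩
      p ^ ν p x * p ^ ν p y * (ε p x * ε p y)            ≡⟨ cong (_* (ε p x * ε p y)) (sym (^-distribˡ-+-* p (ν p x) (ν p y))) ⟩
      p ^ (ν p x + ν p y) * (ε p x * ε p y)              ∎))
    where
    open ≡-Reasoning
    interchange : ∀ a u b v → a * u * (b * v) ≡ a * b * (u * v)
    interchange = solve-∀

  factorial≢0 : ∀ m → m ! ≢ 0
  factorial≢0 m = ≢-nonZero⁻¹ (m !) {{m !≢0}}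

  legendre : ∀ m → q * ν p (m !) + σ p m ≡ m
  legendre zero    = trans (cong (λ v → q * v + 0) ν-one) (cong (_+ 0) (*-zeroʳ q))
  legendre (suc m) = begin
    q * ν p (suc m * m !) + σ p (suc m)            ≡⟨ cong (λ v → q * v + σ p (suc m)) (ν-* (λ ()) (factorial≢0 m)) ⟩
    q * (ν p (suc m) + ν p (m !)) + σ p (suc m)    ≡⟨ regroup q (ν p (suc m)) (ν p (m !)) (σ p (suc m)) ⟩
    σ p (suc m) + q * ν p (suc m) + q * ν p (m !)  ≡⟨ cong (_+ q * ν p (m !)) (σ-succ m) ⟩
    σ p m + 1 + q * ν p (m !)                      ≡⟨ regroup′ (σ p m) (q * ν p (m !)) ⟩
    suc (q * ν p (m !) + σ p m)                    ≡⟨ cong suc (legendre m) ⟩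
    suc m                                          ∎
    where
    open ≡-Reasoning
    regroup : ∀ q a b s → q * (a + b) + s ≡ s + q * a + q * b
    regroup = solve-∀
    regroup′ : ∀ s t → s + 1 + t ≡ suc (t + s)
    regroup′ = solve-∀

  -- Kummer's theorem: ν_p(binom i j) = (σ_p(i) + σ_p(j) - σ_p(i+j)) / (p - 1),
  -- the number of carries when adding i and j in base p.
  kummer : ∀ i j → q * ν p (binom i j) + σ p (i + j) ≡ σ p i + σ p j
  kummer i j = +-cancelʳ-≡ (q * Li + q * Lj) _ _ (begin
    q * ν p (binom i j) + σ p (i + j) + (q * Li + q * Lj)    ≡⟨ regroup q (ν p (binom i j)) Li Lj (σ p (i + j)) ⟩
    q * (ν p (binom i j) + (Li + Lj)) + σ p (i + j)          ≡⟨ cong (λ v → q * v + σ p (i + j)) ν-binom-factorial ⟩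
    q * ν p ((i + j) !) + σ p (i + j)                        ≡⟨ legendre (i + j) ⟩
    i + j                                                    ≡⟨ cong₂ _+_ (sym (legendre i)) (sym (legendre j)) ⟩
    q * Li + σ p i + (q * Lj + σ p j)                        ≡⟨ regroup′ q Li Lj (σ p i) (σ p j) ⟩
    σ p i + σ p j + (q * Li + q * Lj)                        ∎)
    where
    open ≡-Reasoning
    Li Lj : ℕ
    Li = ν p (i !)
    Lj = ν p (j !)
    ν-binom-factorial : ν p (binom i j) + (Li + Lj) ≡ ν p ((i + j) !)
    ν-binom-factorial = begin
      ν p (binom i j) + (Li + Lj)        ≡⟨ cong (ν p (binom i j) +_) (sym (ν-* (factorial≢0 i) (factorial≢0 j))) ⟩
      ν p (binom i j) + ν p (i ! * j !)  ≡⟨ sym (ν-* (binom≢0 i j) (≢-nonZero⁻¹ (i ! * j !) {{i !* j !≢0}})) ⟩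
      ν p (binom i j * (i ! * j !))      ≡⟨ cong (ν p) (binom-factorial i j) ⟩
      ν p ((i + j) !)                    ∎
    regroup : ∀ q c a b s → q * c + s + (q * a + q * b) ≡ q * (c + (a + b)) + s
    regroup = solve-∀
    regroup′ : ∀ q a b s t → q * a + s + (q * b + t) ≡ s + t + (q * a + q * b)
    regroup′ = solve-∀

  kummer-no-carry : ∀ a b → σ p (a + b) ≡ σ p a + σ p b → p ∤ binom a b
  kummer-no-carry a b no-carry p∣B with canonical (binom≢0 a b)
  ... | B≡ , p∤ε = p∤ε (subst (p ∣_) (trans B≡ (trans (cong (λ v → p ^ v * ε p B) ν≡0) (*-identityˡ (ε p B)))) p∣B)
    where
    B : ℕ
    B = binom a b
    qν≡0 : q * ν p B ≡ 0
    qν≡0 = +-cancelʳ-≡ (σ p (a + b)) (q * ν p B) 0 (trans (kummer a b) (sym no-carry))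
    ν≡0 : ν p B ≡ 0
    ν≡0 with m*n≡0⇒m≡0∨n≡0 q qν≡0
    ... | inj₁ q≡0 = ⊥-elim (<-irrefl (sym q≡0) 1≤q)
    ... | inj₂ ν≡0 = ν≡0

  StirlingBound : ℕ → Set
  StirlingBound k = ∀ n m → q * m + σ p n < σ p k + q → p ^ m ∣ S n k

  bound-trivial : ∀ {k n m x} → σ p k ≤ σ p n → q * m + σ p n < σ p k + q → p ^ m ∣ x
  bound-trivial {k} {n} {zero}  _ _ = 1∣ _
  bound-trivial {k} {n} {suc m} σk≤σn h = ⊥-elim (<-irrefl refl (begin-strict
    q + σ p n               ≤⟨ +-monoˡ-≤ (σ p n) (subst (q ≤_) (sym (*-suc q m)) (m≤m+n q (q * m))) ⟩
    q * suc m + σ p n        <⟨ h ⟩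
    σ p k + q                ≤⟨ +-monoˡ-≤ q σk≤σn ⟩
    σ p n + q                ≡⟨ +-comm (σ p n) q ⟩
    q + σ p n                ∎))
    where open ≤-Reasoning

  -- The least m with X ≤ q·m + Y (that is, ⌈(X - Y)/q⌉); minimality is recorded as
  -- "m is 0, or q·m + Y < X + q".
  ceiling : ∀ X Y → Σ ℕ λ m → X ≤ q * m + Y × (m ≡ 0 ⊎ q * m + Y < X + q)
  ceiling zero    Y = 0 , z≤n , inj₁ refl
  ceiling (suc X) Y with ceiling X Y
  ... | m , X≤ , minimal with suc X ≤? q * m + Y
  ...   | yes X<      = m , X< , weaken minimal
    where
    weaken : m ≡ 0 ⊎ q * m + Y < X + q → m ≡ 0 ⊎ q * m + Y < suc X + q
    weaken (inj₁ m≡0) = inj₁ m≡0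
    weaken (inj₂ lt)  = inj₂ (m≤n⇒m≤1+n lt)
  ...   | no X≮ = suc m , subst (suc X ≤_) (sym next) (+-monoˡ-≤ X 1≤q) ,
                  inj₂ (subst (_< suc X + q) (sym next) (subst (_< suc (X + q)) (+-comm X q) (n<1+n (X + q))))
    where
    X≡ : X ≡ q * m + Y
    X≡ = ≤-antisym X≤ (≤-pred (≰⇒> X≮))
    next : q * suc m + Y ≡ q + X
    next = trans (cong (_+ Y) (*-suc q m)) (trans (+-assoc q (q * m) Y) (cong (q +_) (sym X≡)))

  bound-divisor : ∀ {a} → StirlingBound a → ∀ i → Σ ℕ λ m → σ p a ≤ q * m + σ p i × p ^ m ∣ S i a
  bound-divisor {a} Ba i with ceiling (σ p a) (σ p i)
  ... | m , σa≤ , inj₁ refl = 0 , σa≤ , 1∣ _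
  ... | m , σa≤ , inj₂ lt   = m , σa≤ , Ba i m lt

  -- The exponent bookkeeping of the splitting step: the valuations guaranteed for the
  -- three factors of a convolution term add up to at least m.
  exponents-suffice : ∀ {m Sn Sa Sb Si Sj c m₁ m₂} →
    q * m + Sn < Sa + Sb + q → q * c + Sn ≡ Si + Sj →
    Sa ≤ q * m₁ + Si → Sb ≤ q * m₂ + Sj → m ≤ c + (m₁ + m₂)
  exponents-suffice {m} {Sn} {Sa} {Sb} {Si} {Sj} {c} {m₁} {m₂} h kummer-eq Sa≤ Sb≤ =
    ≤-pred (*-cancelˡ-< q m (suc (c + (m₁ + m₂))) (+-cancelʳ-< Sn (q * m) _ (<-≤-trans h total)))
    where
    open ≤-Reasoning
    total : Sa + Sb + q ≤ q * suc (c + (m₁ + m₂)) + Sn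
    total = begin
      Sa + Sb + q                              ≤⟨ +-monoˡ-≤ q (+-mono-≤ Sa≤ Sb≤) ⟩
      q * m₁ + Si + (q * m₂ + Sj) + q          ≡⟨ regroup q m₁ m₂ Si Sj ⟩
      q * m₁ + q * m₂ + q + (Si + Sj)          ≡⟨ cong (q * m₁ + q * m₂ + q +_) (sym kummer-eq) ⟩
      q * m₁ + q * m₂ + q + (q * c + Sn)       ≡⟨ regroup′ q m₁ m₂ c Sn ⟩
      q * suc (c + (m₁ + m₂)) + Sn             ∎
      where
      regroup : ∀ q m₁ m₂ Si Sj → q * m₁ + Si + (q * m₂ + Sj) + q ≡ q * m₁ + q * m₂ + q + (Si + Sj)
      regroup = solve-∀
      regroup′ : ∀ q m₁ m₂ c Sn → q * m₁ + q * m₂ + q + (q * c + Sn) ≡ q * suc (c + (m₁ + m₂)) + Sn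
      regroup′ = solve-∀

  -- The inductive step: if a + b has no carries, the bound for a and for b gives the
  -- bound for a + b, through binom a b · S(n,a+b) = Σ_{i+j=n} binom i j · S(i,a) · S(j,b)
  -- and p ∤ binom a b.
  bound-split : ∀ a b → σ p (a + b) ≡ σ p a + σ p b →
    StirlingBound a → StirlingBound b → StirlingBound (a + b)
  bound-split a b no-carry Ba Bb n m h =
    p^-cancel m (binom a b) (S n (a + b)) (kummer-no-carry a b no-carry)
      (subst (p ^ m ∣_) (stirling-conv n a b) (antidiag-∣ (p ^ m) _ n term))
    where
    term : ∀ i j → i + j ≡ n → p ^ m ∣ binom i j * (S i a * S j b)
    term i j refl with bound-divisor Ba i | bound-divisor Bb j
    ... | m₁ , σa≤ , p^m₁∣ | m₂ , σb≤ , p^m₂∣ =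
      ∣-trans (p^-mono-∣ (exponents-suffice (subst (λ s → q * m + σ p n < s + q) no-carry h) (kummer i j) σa≤ σb≤))
        (subst (_∣ binom i j * (S i a * S j b)) (sym p^-split)
          (*-pres-∣ (p^ν∣ (binom≢0 i j)) (*-pres-∣ p^m₁∣ p^m₂∣)))
      where
      c : ℕ
      c = ν p (binom i j)
      p^-split : p ^ (c + (m₁ + m₂)) ≡ p ^ c * (p ^ m₁ * p ^ m₂)
      p^-split = trans (^-distribˡ-+-* p c (m₁ + m₂)) (cong (p ^ c *_) (^-distribˡ-+-* p m₁ m₂))

  -- For k = p^e · w (p ∤ w): either k is a power of p (σ(k) = 1), or k splits as
  -- p^e + p^e · (w - 1) without carries into two smaller numbers.
  bound-factored : ∀ k e w → WfRec _<_ StirlingBound (suc k) →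
    suc k ≡ p ^ e * w → p ∤ w → StirlingBound (suc k)
  bound-factored k e zero _ _ p∤w = ⊥-elim (p∤⇒≢0 p∤w refl)
  bound-factored k e (suc zero) _ k≡ _ zero    m _ = (p ^ m) ∣0
  bound-factored k e (suc zero) _ k≡ _ (suc n) m h =
    bound-trivial (subst (_≤ σ p (suc n)) (sym σk≡1) (σ-pos (λ ()))) h
    where
    σk≡1 : σ p (suc k) ≡ 1
    σk≡1 = trans (cong (σ p) k≡) (trans (σ-scale e 1) σ-one)
  bound-factored k e (suc (suc w)) IH k≡ p∤w =
    subst StirlingBound (sym k≡a+b) (bound-split a b no-carry (IH a<k) (IH b<k))
    where
    a b : ℕ
    a = p ^ e
    b = p ^ e * suc w
    k≡a+b : suc k ≡ a + b
    k≡a+b = trans k≡ (*-suc (p ^ e) (suc w))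
    no-carry : σ p (a + b) ≡ σ p a + σ p b
    no-carry = begin
      σ p (a + b)                     ≡⟨ cong (σ p) (sym k≡a+b) ⟩
      σ p (suc k)                     ≡⟨ trans (cong (σ p) k≡) (σ-scale e (suc (suc w))) ⟩
      σ p (suc (suc w))               ≡⟨ sym (+-identityʳ _) ⟩
      σ p (suc (suc w)) + 0           ≡⟨ cong (σ p (suc (suc w)) +_) (sym (*-zeroʳ q)) ⟩
      σ p (suc (suc w)) + q * 0       ≡⟨ σ-carry 0 (suc w) (suc (suc w)) (sym (*-identityˡ _)) p∤w ⟩
      σ p (suc w) + 1                 ≡⟨ +-comm (σ p (suc w)) 1 ⟩
      1 + σ p (suc w)                 ≡⟨ cong₂ _+_ (sym (trans (cong (σ p) (sym (*-identityʳ a))) (trans (σ-scale e 1) σ-one)))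
                                                   (sym (σ-scale e (suc w))) ⟩
      σ p a + σ p b                   ∎
      where open ≡-Reasoning
    a<k : a < suc k
    a<k = subst (a <_) (sym k≡a+b) (m<m+n a (<-≤-trans (m^n>0 p e) (m≤m*n (p ^ e) (suc w))))
    b<k : b < suc k
    b<k = subst (b <_) (sym k≡a+b) (m<n+m b (m^n>0 p e))

  stirling-bound : ∀ k → StirlingBound k
  stirling-bound = <-rec StirlingBound step
    where
    step : ∀ k → WfRec _<_ StirlingBound k → StirlingBound k
    step zero    _  n m h = bound-trivial {0} {n} z≤n h
    step (suc k) IH with canonical {suc k} (λ ())
    ... | k≡ , p∤ε = bound-factored k (ν p (suc k)) (ε p (suc k)) IH k≡ p∤ε

  -- The factor of p^{v+1} not supplied by k + c + 1 comes from the bound for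
  -- S(n+c, k+c+1): with v = α + r, σ(n+c) and σ(k+c+1) leave room for p^{r+1}.
  shift-step-bound : ∀ {n k c α r} → q * (α + r) + σ p n ≡ σ p k →
    σ p (suc c) + q * α ≡ σ p c + 1 →
    σ p (n + c) ≡ σ p n + σ p c → σ p (k + suc c) ≡ σ p k + σ p (suc c) →
    p ^ suc r ∣ S (n + c) (k + suc c)
  shift-step-bound {n} {k} {c} {α} {r} minimum carry σn+c σk+c+1 =
    stirling-bound (k + suc c) (n + c) (suc r) (begin-strict
      q * suc r + σ p (n + c)                 ≡⟨ cong (q * suc r +_) σn+c ⟩
      q * suc r + (σ p n + σ p c)             <⟨ n<1+n _ ⟩
      suc (q * suc r + (σ p n + σ p c))       ≡⟨ sym digit-sums ⟩
      σ p k + σ p (suc c) + q                 ≡⟨ cong (_+ q) (sym σk+c+1) ⟩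
      σ p (k + suc c) + q                     ∎)
    where
    open ≤-Reasoning
    digit-sums : σ p k + σ p (suc c) + q ≡ suc (q * suc r + (σ p n + σ p c))
    digit-sums = begin-equality
      σ p k + σ p (suc c) + q                         ≡⟨ cong (λ s → s + σ p (suc c) + q) (sym minimum) ⟩
      q * (α + r) + σ p n + σ p (suc c) + q           ≡⟨ regroup q α r (σ p n) (σ p (suc c)) ⟩
      σ p (suc c) + q * α + (q * r + σ p n + q)       ≡⟨ cong (_+ (q * r + σ p n + q)) carry ⟩
      σ p c + 1 + (q * r + σ p n + q)                 ≡⟨ regroup′ q r (σ p n) (σ p c) ⟩
      suc (q * suc r + (σ p n + σ p c))               ∎
      where
      regroup : ∀ q α r Sn Sd → q * (α + r) + Sn + Sd + q ≡ Sd + q * α + (q * r + Sn + q)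
      regroup = solve-∀
      regroup′ : ∀ q r Sn Sc → Sc + 1 + (q * r + Sn + q) ≡ suc (q * suc r + (Sn + Sc))
      regroup′ = solve-∀

  p^ν∣-shift : ∀ E {k c} → p ^ E ∣ k → suc c < p ^ E → p ^ ν p (suc c) ∣ k + suc c
  p^ν∣-shift E {k} {c} p^E∣k c+1<p^E =
    ∣m∣n⇒∣m+n (∣-trans (p^-mono-∣ (<⇒≤ α<E)) p^E∣k) (p^ν∣ (λ ()))
    where
    α : ℕ
    α = ν p (suc c)
    α<E : α < E
    α<E = ≰⇒> (λ E≤α → <-irrefl refl
            (<-≤-trans c+1<p^E (≤-trans (^-monoʳ-≤ p E≤α) (∣⇒≤ (p^ν∣ {suc c} (λ ()))))))

  -- With α = ν(c+1), the factor k+c+1 contributes p^α and shift-step-bound the rest.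
  shift-step : ∀ E₁ E₂ {n k v c} → p ^ E₁ ∣ n → p ^ E₂ ∣ k → q * v + σ p n ≡ σ p k →
    suc c < p ^ E₁ → suc c < p ^ E₂ → p ^ suc v ∣ (k + suc c) * S (n + c) (k + suc c)
  shift-step E₁ E₂ {n} {k} {v} {c} p^E₁∣n p^E₂∣k minimum c+1<p^E₁ c+1<p^E₂
    with suc v ≤? ν p (suc c)
  ... | yes v<α = ∣-trans (p^-mono-∣ v<α) (∣m⇒∣m*n _ (p^ν∣-shift E₂ p^E₂∣k c+1<p^E₂))
  ... | no  v≮α with m≤n⇒∃[o]m+o≡n (≤-pred (≰⇒> v≮α))
  ...   | r , α+r≡v =
    subst (_∣ (k + suc c) * S (n + c) (k + suc c))
      (trans (sym (^-distribˡ-+-* p (ν p (suc c)) (suc r)))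
             (cong (p ^_) (trans (+-suc (ν p (suc c)) r) (cong suc α+r≡v))))
      (*-pres-∣ (p^ν∣-shift E₂ p^E₂∣k c+1<p^E₂)
        (shift-step-bound {n} {k} (subst (λ v → q * v + σ p n ≡ σ p k) (sym α+r≡v) minimum) (σ-succ c)
          (σ-add E₁ p^E₁∣n (<-trans (n<1+n c) c+1<p^E₁)) (σ-add E₂ p^E₂∣k c+1<p^E₂)))

  shift-congruence : ∀ E₁ E₂ {n k v} b → p ^ E₁ ∣ n → p ^ E₂ ∣ k → q * v + σ p n ≡ σ p k →
    b < p ^ E₁ → b < p ^ E₂ → Σ ℕ λ t → S (n + b) (k + b) ≡ S n k + p ^ suc v * t
  shift-congruence E₁ E₂ {n} {k} {v} zero _ _ _ _ _ =
    0 , trans (cong₂ S (+-identityʳ n) (+-identityʳ k))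
              (sym (trans (cong (S n k +_) (*-zeroʳ (p ^ suc v))) (+-identityʳ (S n k))))
  shift-congruence E₁ E₂ {n} {k} {v} (suc c) p^E₁∣n p^E₂∣k minimum c+1<p^E₁ c+1<p^E₂
    with shift-congruence E₁ E₂ c p^E₁∣n p^E₂∣k minimum (<-trans (n<1+n c) c+1<p^E₁) (<-trans (n<1+n c) c+1<p^E₂)
       | shift-step E₁ E₂ {c = c} p^E₁∣n p^E₂∣k minimum c+1<p^E₁ c+1<p^E₂
  ... | t , S≡ | divides t′ step≡ = t′ + t , (begin
    S (n + suc c) (k + suc c)                               ≡⟨ cong₂ S (+-suc n c) (+-suc k c) ⟩
    suc (k + c) * S (n + c) (suc (k + c)) + S (n + c) (k + c) ≡⟨ cong (λ m → m * S (n + c) m + S (n + c) (k + c)) (sym (+-suc k c)) ⟩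
    (k + suc c) * S (n + c) (k + suc c) + S (n + c) (k + c) ≡⟨ cong₂ _+_ step≡ S≡ ⟩
    t′ * p ^ suc v + (S n k + p ^ suc v * t)                ≡⟨ regroup t′ (p ^ suc v) (S n k) t ⟩
    S n k + p ^ suc v * (t′ + t)                            ∎)
    where
    open ≡-Reasoning
    regroup : ∀ t′ P s t → t′ * P + (s + P * t) ≡ s + P * (t′ + t)
    regroup = solve-∀

-- Theorem 2.3.  With v = ν(S(n,k)) and u = ε(S(n,k)), shift-congruence gives
-- S(n+b, k+b) = p^v·u + p^{v+1}·t, so perturbation yields (i) and (ii); the digit sums of
-- n and k both grow by σ(b), so the minimum zero equation persists.
theorem2p3 : (p : ℕ) → .{{_ : NonZero p}} → Prime p → (n k : ℕ) → 1 ≤ n → 1 ≤ k →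
    MinZeroCase p n k → (b : ℕ) → b < p ^ ν p k → b < p ^ ν p n →
      MinZeroCase p (n + b) (k + b)
      × ν p (S (n + b) (k + b)) ≡ ν p (S n k)
      × ε p (S (n + b) (k + b)) % p ≡ ε p (S n k) % p
theorem2p3 p p-prime n k 1≤n 1≤k (S≢0 , minimum) b b<p^νk b<p^νn =
  (proj₁ perturbed , minimum′) , ν-same , proj₂ (proj₂ perturbed)
  where
  open AtPrime p p-prime
  open ≡-Reasoning
  v : ℕ
  v = ν p (S n k)
  n≢0 : n ≢ 0
  n≢0 = ≢-nonZero⁻¹ n {{>-nonZero 1≤n}}
  k≢0 : k ≢ 0
  k≢0 = ≢-nonZero⁻¹ k {{>-nonZero 1≤k}}
  shifted : Σ ℕ λ t → S (n + b) (k + b) ≡ S n k + p ^ suc v * t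
  shifted = shift-congruence (ν p n) (ν p k) b (p^ν∣ n≢0) (p^ν∣ k≢0) minimum b<p^νn b<p^νk
  perturbed : S (n + b) (k + b) ≢ 0 × ν p (S (n + b) (k + b)) ≡ v
            × ε p (S (n + b) (k + b)) % p ≡ ε p (S n k) % p
  perturbed = perturbation (proj₁ shifted) (proj₂ (canonical S≢0))
                (trans (proj₂ shifted) (cong (_+ p ^ suc v * proj₁ shifted) (proj₁ (canonical S≢0))))
  ν-same : ν p (S (n + b) (k + b)) ≡ v
  ν-same = proj₁ (proj₂ perturbed)
  minimum′ : q * ν p (S (n + b) (k + b)) + σ p (n + b) ≡ σ p (k + b)
  minimum′ = begin
    q * ν p (S (n + b) (k + b)) + σ p (n + b)  ≡⟨ cong₂ _+_ (cong (q *_) ν-same) (σ-add (ν p n) (p^ν∣ n≢0) b<p^νn) ⟩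
    q * v + (σ p n + σ p b)                    ≡⟨ sym (+-assoc (q * v) (σ p n) (σ p b)) ⟩
    q * v + σ p n + σ p b                      ≡⟨ cong (_+ σ p b) minimum ⟩
    σ p k + σ p b                              ≡⟨ sym (σ-add (ν p k) (p^ν∣ k≢0) b<p^νk) ⟩
    σ p (k + b)                                ∎
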